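{- Let $\mathcal{A}$ be a tree automaton over a finite signature ${\cal F}$ and let $E$ be a set of equations with $E \supseteq E^{r}$. If $\mathcal{A} \leadsto_E^! \mathcal{A}'$ (i.e. $\mathcal{A}\leadsto_E^*\mathcal{A}'$ and $\mathcal{A}'$ is irreducible by $\leadsto_E$), then $\mathcal{A}'$ is $\not\varepsilon$-deterministic.
   Context: ${\cal F}$ is a finite set of function symbols with arities, ${\cal X}$ a countable set of variables, ${\cal T(F,X)}$ the terms and ${\cal T(F)}$ the ground terms. An equation is a pair $l=r$ with $l,r\in{\cal T(F,X)}$. Let $\mathcal{Q}$ be a countably infinite set of constants (states) disjoint from ${\cal F}$. A transition is a rewrite rule $c\to q$ with $c\in{\cal T}({\cal F}\cup\mathcal{Q})$ and $q\in\mathcal{Q}$; it is normalized if $c=f(q_1,\dots,q_n)$ with $f\in{\cal F}$ of arity $n$ and $q_i\in\mathcal{Q}$; an $\varepsilon$-transition is one of the form $q\to q'$ with $q,q'\in\mathcal{Q}$. A tree automaton is $\mathcal{A}=\langle{\cal F},\mathcal{Q},\mathcal{Q}_f,\Delta\rangle$ with $\mathcal{Q}_f\subseteq\mathcal{Q}$ finite and $\Delta$ a finite set of normalized transitions and $\varepsilon$-transitions. $\to^{\not\varepsilon *}_{\mathcal{A}}$ denotes the reflexive-transitive rewriting relation on ${\cal T}({\cal F}\cup\mathcal{Q})$ induced by the normalized (non-$\varepsilon$) transitions of $\Delta$. $\mathcal{A}$ is $\not\varepsilon$-deterministic if no two distinct normalized transitions of $\Delta$ have the same left-hand side. A state substitution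 is a map $\sigma:{\cal X}\to\mathcal{Q}$, extended homomorphically to terms. For a function $\alpha$ on states, $\mathcal{A}\alpha$ is the automaton obtained by replacing every state $q$ by $\alpha(q)$ in the state set, in $\mathcal{Q}_f$ and in all left- and right-hand sides of transitions. Simplification relation: for a set of equations $E$, $\mathcal{A}\leadsto_E\mathcal{A}'$ holds if there are $s=t\in E$, a state substitution $\sigma$ and states $q_a\neq q_b$ with $s\sigma\to^{\not\varepsilon *}_{\mathcal{A}}q_a$ and $t\sigma\to^{\not\varepsilon *}_{\mathcal{A}}q_b$, and $\mathcal{A}'=\mathcal{A}\{q_b\mapsto q_a\}$. The set of reflexivity equations is $E^{r}=\{f(x_1,\dots,x_n)=f(x_1,\dots,x_n)\mid f\in{\cal F}\text{ of arity }n\}$, with $x_1,\dots,x_n$ pairwise distinct variables. -}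

module Defs where

open import Data.Nat using (ℕ; _≟_)
open import Data.Fin using (Fin; toℕ)
open import Data.Vec using (Vec; []; _∷_; tabulate)
open import Data.List using (List)
import Data.List as List
open import Data.List.Membership.Propositional using (_∈_)
open import Data.Product using (Σ; ∃; _×_; _,_)
open import Relation.Nullary using (¬_; yes; no)
open import Relation.Binary.PropositionalEquality using (_≡_; _≢_)
open import Relation.Binary.Construct.Closure.ReflexiveTransitive using (Star)

record Sig : Set where
  field
    size  : ℕ
    arity : Fin size → ℕ
open Sig public

State : Set
State = ℕ

Var : Set
Var = ℕ

-- Terms over F with leaves in L.
--   T(F,X)      = Tm S Var
--   T(F ∪ Q)    = Tm S State
data Tm (S : Sig) (L : Set) : Set where
  leaf : L → Tm S L
  app  : (f : Fin (size S)) → Vec (Tm S L) (arity S f) → Tm S L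

mutual
  _·_ : {S : Sig} → Tm S Var → (Var → State) → Tm S State
  leaf x   · σ = leaf (σ x)
  app f ts · σ = app f (ts ·v σ)

  _·v_ : {S : Sig} {k : ℕ} → Vec (Tm S Var) k → (Var → State) → Vec (Tm S State) k
  []       ·v σ = []
  (t ∷ ts) ·v σ = (t · σ) ∷ (ts ·v σ)

stateVec : {S : Sig} {k : ℕ} → Vec State k → Vec (Tm S State) k
stateVec []       = []
stateVec (q ∷ qs) = leaf q ∷ stateVec qs

data Trans (S : Sig) : Set where
  norm : (f : Fin (size S)) → Vec State (arity S f) → State → Trans S
  eps  : State → State → Trans S

-- Tree automaton ⟨F, Q, Q_f, Δ⟩ (F fixed by S, Q = ℕ).
record Automaton (S : Sig) : Set where
  constructor ⟨_,_⟩
  field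
    finals : List State
    delta  : List (Trans S)
open Automaton public

mutual
  data _⊢_⟶_ {S : Sig} (Δ : List (Trans S)) : Tm S State → Tm S State → Set where
    root : ∀ {f qs q} → norm f qs q ∈ Δ → Δ ⊢ app f (stateVec qs) ⟶ leaf q
    arg  : ∀ {f ts ts'} → Δ ⊢ ts ⟶v ts' → Δ ⊢ app f ts ⟶ app f ts'

  data _⊢_⟶v_ {S : Sig} (Δ : List (Trans S)) : {k : ℕ} → Vec (Tm S State) k → Vec (Tm S State) k → Set where
    here  : ∀ {k t t'} {ts : Vec (Tm S State) k} → Δ ⊢ t ⟶ t' → Δ ⊢ (t ∷ ts) ⟶v (t' ∷ ts)
    there : ∀ {k t} {ts ts' : Vec (Tm S State) k} → Δ ⊢ ts ⟶v ts' → Δ ⊢ (t ∷ ts) ⟶v (t ∷ ts')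

_⊢_⟶*_ : {S : Sig} → Automaton S → Tm S State → Tm S State → Set
A ⊢ s ⟶* t = Star (delta A ⊢_⟶_) s t

renameT : {S : Sig} → (State → State) → Trans S → Trans S
renameT α (norm f qs q) = norm f (Data.Vec.map α qs) (α q)
  where import Data.Vec
renameT α (eps q q')    = eps (α q) (α q')

rename : {S : Sig} → (State → State) → Automaton S → Automaton S
rename α A = ⟨ List.map α (finals A) , List.map (renameT α) (delta A) ⟩

[_↦_] : State → State → State → State
[ qb ↦ qa ] q with q ≟ qb
... | yes _ = qa
... | no  _ = q

Equations : Sig → Set₁
Equations S = Tm S Var → Tm S Var → Set

_⊢_⇝_ : {S : Sig} → Equations S → Automaton S → Automaton S → Set
_⊢_⇝_ {S} E A A' =
  Σ (Tm S Var) λ s → Σ (Tm S Var) λ t → E s t ×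
  Σ (Var → State) λ σ → Σ State λ qa → Σ State λ qb →
    qa ≢ qb × (A ⊢ (s · σ) ⟶* leaf qa) × (A ⊢ (t · σ) ⟶* leaf qb) ×
    A' ≡ rename [ qb ↦ qa ] A

_⊢_⇝*_ : {S : Sig} → Equations S → Automaton S → Automaton S → Set
E ⊢ A ⇝* A' = Star (E ⊢_⇝_) A A'

Irreducible : {S : Sig} → Equations S → Automaton S → Set
Irreducible {S} E A = ¬ (Σ (Automaton S) λ A' → E ⊢ A ⇝ A')

_⊢_⇝!_ : {S : Sig} → Equations S → Automaton S → Automaton S → Set
E ⊢ A ⇝! A' = (E ⊢ A ⇝* A') × Irreducible E A'

reflTerm : {S : Sig} → Fin (size S) → Tm S Var
reflTerm {S} f = app f (tabulate (λ i → leaf (toℕ i)))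

ContainsReflexivity : {S : Sig} → Equations S → Set
ContainsReflexivity {S} E = (f : Fin (size S)) → E (reflTerm f) (reflTerm f)

NonEpsDeterministic : {S : Sig} → Automaton S → Set
NonEpsDeterministic {S} A =
  ∀ (f : Fin (size S)) (qs : Vec State (arity S f)) (q q' : State) →
    norm f qs q ∈ delta A → norm f qs q' ∈ delta A → q ≡ q'

-- Idea: suppose Δ contains two normalized transitions f(q₁,…,qₙ) → q and
-- f(q₁,…,qₙ) → q' with q ≠ q'.  Instantiate the reflexivity equation
-- f(x₀,…,xₙ₋₁) = f(x₀,…,xₙ₋₁) with the state substitution σ(xᵢ) = qᵢ₊₁.
-- Both sides become f(q₁,…,qₙ), which rewrites in one step to q and to q'
-- respectively, so the automaton admits the simplification step merging q'
-- into q, contradicting irreducibility.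
--
-- The theorem follows since the end point of ⇝^! is
-- irreducible by definition.
module Submission where

open import Defs
open import Data.Nat using (ℕ; zero; suc; _≟_)
open import Data.Fin using (Fin; toℕ)
import Data.Fin as Fin
open import Data.Vec using (Vec; []; _∷_; tabulate; lookup)
open import Data.Vec.Properties using (tabulate∘lookup; tabulate-cong)
open import Data.List.Membership.Propositional using (_∈_)
open import Data.Product using (_,_; proj₂)
open import Data.Empty using (⊥-elim)
open import Relation.Nullary using (yes; no)
open import Relation.Binary.PropositionalEquality using (_≡_; refl; cong; subst; sym; module ≡-Reasoning)
open import Relation.Binary.Construct.Closure.ReflexiveTransitive using (ε; _◅_)

-- The state substitution xᵢ ↦ qᵢ₊₁ determined by a vector of states
-- (variables beyond the length of the vector are sent to the state 0).
fromStates : {k : ℕ} → Vec State k → Var → State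
fromStates []       _       = 0
fromStates (q ∷ qs) zero    = q
fromStates (q ∷ qs) (suc n) = fromStates qs n

fromStates-toℕ : {k : ℕ} (qs : Vec State k) (i : Fin k) →
  fromStates qs (toℕ i) ≡ lookup qs i
fromStates-toℕ (q ∷ qs) Fin.zero    = refl
fromStates-toℕ (q ∷ qs) (Fin.suc i) = fromStates-toℕ qs i

subst-tabulate : {S : Sig} {k : ℕ} (h : Fin k → Var) (σ : Var → State) →
  _·v_ {S} (tabulate (λ i → leaf (h i))) σ ≡ stateVec (tabulate (λ i → σ (h i)))
subst-tabulate {k = zero}  h σ = refl
subst-tabulate {k = suc k} h σ =
  cong (leaf (σ (h Fin.zero)) ∷_) (subst-tabulate (λ i → h (Fin.suc i)) σ)

reflTerm-instance : {S : Sig} (f : Fin (size S)) (qs : Vec State (arity S f)) →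
  reflTerm f · fromStates qs ≡ app f (stateVec qs)
reflTerm-instance {S} f qs = cong (app f) (begin
  tabulate (λ i → leaf (toℕ i)) ·v fromStates qs
    ≡⟨ subst-tabulate toℕ (fromStates qs) ⟩
  stateVec {S} (tabulate (λ i → fromStates qs (toℕ i)))
    ≡⟨ cong stateVec (tabulate-cong (fromStates-toℕ qs)) ⟩
  stateVec (tabulate (lookup qs))
    ≡⟨ cong stateVec (tabulate∘lookup qs) ⟩
  stateVec qs ∎)
  where open ≡-Reasoning

transition-run : {S : Sig} (A : Automaton S) {f : Fin (size S)}
  {qs : Vec State (arity S f)} {q : State} →
  norm f qs q ∈ delta A → A ⊢ (reflTerm f · fromStates qs) ⟶* leaf q
transition-run A {f} {qs} {q} q∈Δ =
  subst (λ t → A ⊢ t ⟶* leaf q) (sym (reflTerm-instance f qs)) (root q∈Δ ◅ ε)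

irreducible⇒deterministic : {S : Sig} (E : Equations S) (A : Automaton S) →
  ContainsReflexivity E → Irreducible E A → NonEpsDeterministic A
irreducible⇒deterministic E A Er⊆E irr f qs q q' q∈Δ q'∈Δ with q ≟ q'
... | yes q≡q' = q≡q'
... | no  q≢q' = ⊥-elim (irr (rename [ q' ↦ q ] A , merge))
  where
  merge : E ⊢ A ⇝ rename [ q' ↦ q ] A
  merge = reflTerm f , reflTerm f , Er⊆E f , fromStates qs , q , q' , q≢q'
        , transition-run A q∈Δ , transition-run A q'∈Δ , refl

lemma1 : {S : Sig} (E : Equations S) (A A' : Automaton S) →
    ContainsReflexivity E → E ⊢ A ⇝! A' → NonEpsDeterministic A'
lemma1 E A A' Er⊆E A⇝!A' = irreducible⇒deterministic E A' Er⊆E (proj₂ A⇝!A')
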